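{- For every integer $n\geq 2$, there exists a $2$-degenerate graph $G^2_n$ of order $n$ such that $\mathrm{id}^{\leq 3}(G^2_n) = n-1$. Moreover, if $n$ is even then $\mathrm{conv}^{\leq 3}(G^2_n) = n-1$, and if $n$ is odd then $\mathrm{conv}^{\leq 3}(G^2_n) = n-2$.
   Context: All graphs are finite and simple. A graph is $2$-degenerate if its vertices admit an ordering $(v_1,\dots,v_n)$ such that each $v_i$ has at most $2$ neighbours in $\{v_{i+1},\dots,v_n\}$. In an oriented graph, the inversion of a vertex set $X$ reverses the orientation of every arc with both endvertices in $X$; a $(\leq p)$-inversion is the inversion of a set of at most $p$ vertices. $\mathrm{id}^{\leq p}(G)$ is the maximum, over all pairs of orientations $\vec G_1,\vec G_2$ of (the labelled graph) $G$, of the minimum number of $(\leq p)$-inversions transforming $\vec G_1$ into $\vec G_2$. $\mathrm{conv}^{\leq p}(G)$ is the minimum number of $(\leq p)$-inversions transforming an orientation of $G$ into its converse (all arcs reversed); this does not depend on the orientation. -}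

module Defs where

open import Data.Nat using (ℕ; _≤_; _<_)
open import Data.Bool using (Bool; true; false; if_then_else_; _∧_)
open import Data.Fin using (Fin)
import Data.Fin as F
open import Data.Fin.Subset using (Subset; ∣_∣)
open import Data.Vec using (lookup)
open import Data.List using (List; []; _∷_; length; foldl)
open import Data.List.Relation.Unary.All using (All)
open import Data.Product using (Σ; ∃; _×_; _,_)
open import Data.Sum using (_⊎_)
open import Data.Empty using (⊥)
open import Relation.Nullary using (¬_)
open import Relation.Binary.PropositionalEquality using (_≡_)
open import Function.Definitions using (Injective)

record Graph (n : ℕ) : Set₁ where
  field
    Adj     : Fin n → Fin n → Set
    sym     : ∀ {u v} → Adj u v → Adj v u
    irrefl  : ∀ {v} → ¬ Adj v v
open Graph public

-- 2-degenerate: there is an ordering (injective position map into Fin n,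
-- hence a bijection) such that no vertex has 3 distinct neighbours later
-- in the ordering (i.e. each vertex has at most 2 later neighbours).
TwoDegenerate : ∀ {n} → Graph n → Set
TwoDegenerate {n} G =
  Σ (Fin n → Fin n) λ pos → Injective _≡_ _≡_ pos ×
    (∀ v a b c → Adj G v a → Adj G v b → Adj G v c →
       pos v F.< pos a → pos v F.< pos b → pos v F.< pos c →
       ¬ (a ≡ b) → ¬ (a ≡ c) → ¬ (b ≡ c) → ⊥)

-- Raw arc relation: arc u v ≡ true means u → v.
Arcs : ℕ → Set
Arcs n = Fin n → Fin n → Bool

IsOrientation : ∀ {n} → Graph n → Arcs n → Set
IsOrientation {n} G o =
  (∀ u v → o u v ≡ true → Adj G u v) ×
  (∀ u v → Adj G u v → o u v ≡ true ⊎ o v u ≡ true) ×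
  (∀ u v → o u v ≡ true → o v u ≡ true → ⊥)

_≈ₒ_ : ∀ {n} → Arcs n → Arcs n → Set
o ≈ₒ o' = ∀ u v → o u v ≡ o' u v

invert : ∀ {n} → Subset n → Arcs n → Arcs n
invert X o u v = if (lookup X u ∧ lookup X v) then o v u else o u v

converse : ∀ {n} → Arcs n → Arcs n
converse o u v = o v u

invertAll : ∀ {n} → List (Subset n) → Arcs n → Arcs n
invertAll Xs o = foldl (λ acc X → invert X acc) o Xs

Transforms : ∀ {n} → ℕ → ℕ → Arcs n → Arcs n → Set
Transforms {n} p k o₁ o₂ =
  Σ (List (Subset n)) λ Xs →
    length Xs ≡ k × All (λ X → ∣ X ∣ ≤ p) Xs × (invertAll Xs o₁ ≈ₒ o₂)

MinInv : ∀ {n} → ℕ → Arcs n → Arcs n → ℕ → Set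
MinInv p o₁ o₂ k = Transforms p k o₁ o₂ × (∀ j → Transforms p j o₁ o₂ → k ≤ j)

-- id^{≤p}(G) = m : max over pairs of orientations of the minimum number.
InvDiamEq : ∀ {n} → ℕ → Graph n → ℕ → Set
InvDiamEq p G m =
  (∀ o₁ o₂ → IsOrientation G o₁ → IsOrientation G o₂ →
     ∃ λ k → MinInv p o₁ o₂ k × k ≤ m) ×
  (∃ λ o₁ → ∃ λ o₂ → IsOrientation G o₁ × IsOrientation G o₂ × MinInv p o₁ o₂ m)

-- conv^{≤p}(G) = m : for an (equivalently: every) orientation, the minimum
-- number of (≤ p)-inversions transforming it into its converse is m.
ConvEq : ∀ {n} → ℕ → Graph n → ℕ → Set
ConvEq p G m = ∀ o → IsOrientation G o → MinInv p o (converse o) m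

-- The graph is the book K₂ + K̄ₖ (n = k + 2): a spine edge s₀s₁ and k pages, each adjacent to both
-- spine vertices. Two orientations differ on a set D of edges, and inverting X₁, …, Xₘ turns one
-- into the other iff D is the set of edges lying in an odd number of the Xᵢ.
-- Upper bound: for each page j invert {j} together with the spine vertices whose edge to j is in D,
-- then invert {s₀, s₁} if the spine edge still has the wrong parity: at most k + 1 inversions.
-- Lower bound: let z record whether s₀s₁ ∈ D, let x and y count the pages joined to s₀, resp. s₁, by
-- an edge of D, and let ⌈w⌉_z be the least m ≥ w with parity z. An inversion of at most 3 vertices
-- raises ⌈x⌉_z + ⌈y⌉_z by at most 2: containing one spine vertex it changes x or y by at most 2,
-- containing both it flips z and changes each of x, y by at most 1. When D contains every page edge
-- this potential is 2⌈k⌉_z and the construction above uses exactly ⌈k⌉_z inversions; this is k + 1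
-- for z ≠ parity of k, and for the converse (z = 1) it is n − 1 for even n and n − 2 for odd n.
{-# OPTIONS --safe #-}
module Submission where

open import Defs hiding (sym)
open import Algebra.Bundles using (CommutativeRing)
open import Data.Bool using (Bool; true; false; not; _∧_; _xor_; if_then_else_)
open import Data.Bool.Properties
  using (not-involutive; not-injective; ∧-comm; ∧-identityʳ; ∧-zeroʳ; xor-assoc; xor-comm; xor-same;
         xor-identityʳ; xor-inverseˡ; xor-inverseʳ; xor-annihilates-not; not-distribˡ-xor;
         not-distribʳ-xor; if-float; if-eta; xor-∧-commutativeRing)
import Data.Bool.Properties as Bool
open import Data.Empty using (⊥; ⊥-elim)
open import Data.Fin using (Fin; zero; suc; opposite)
import Data.Fin as Fin
open import Data.Fin.Properties using (toℕ-injective; opposite-prop; opposite-involutive; all?)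
open import Data.Fin.Subset using (Subset; ∣_∣; ⁅_⁆) renaming (⊥ to ∅)
open import Data.Fin.Subset.Properties using (∣⊥∣≡0; ∣⁅x⁆∣≡1; anySubset?)
open import Data.List using (List; []; _∷_; _++_; length; tabulate)
open import Data.List.Properties using (length-++; length-tabulate)
open import Data.List.Relation.Unary.All using (All; []; _∷_)
open import Data.List.Relation.Unary.All.Properties using (++⁺; tabulate⁺)
open import Data.Nat using (ℕ; zero; suc; _≤_; _<_; _+_; _*_; _∸_; _%_; z≤n; s≤s; s<s⁻¹; _≤?_)
open import Data.Nat.Properties
open import Data.Product using (Σ; ∃; _×_; _,_; proj₁; proj₂)
open import Data.Sum using (_⊎_; inj₁; inj₂; [_,_]′)
import Data.Sum as Sum
open import Data.Unit using (⊤; tt)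
import Data.Vec as Vec
open Vec using (lookup; []; _∷_)
open import Data.Vec.Properties using (lookup-replicate; tabulate-cong)
open import Function using (_∘_)
open import Function.Definitions using (Injective)
open import Relation.Binary.PropositionalEquality
open import Relation.Nullary using (¬_; Dec; yes; no; contradiction)
open import Relation.Nullary.Decidable using (_×-dec_)
import Relation.Nullary.Decidable as Dec
open import Relation.Unary using (Decidable)

open CommutativeRing xor-∧-commutativeRing using (+-monoid)
import Algebra.Properties.Monoid.Sum +-monoid as Xor

coParity : ∀ {n} → List (Subset n) → Fin n → Fin n → Bool
coParity []       u v = false
coParity (X ∷ Xs) u v = (lookup X u ∧ lookup X v) xor coParity Xs u v

coParity-sym : ∀ {n} (Xs : List (Subset n)) u v → coParity Xs u v ≡ coParity Xs v u
coParity-sym []       u v = refl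
coParity-sym (X ∷ Xs) u v = cong₂ _xor_ (∧-comm (lookup X u) (lookup X v)) (coParity-sym Xs u v)

coParity-++ : ∀ {n} (Xs Ys : List (Subset n)) u v →
              coParity (Xs ++ Ys) u v ≡ coParity Xs u v xor coParity Ys u v
coParity-++ []       Ys u v = refl
coParity-++ (X ∷ Xs) Ys u v = trans (cong ((lookup X u ∧ lookup X v) xor_) (coParity-++ Xs Ys u v))
                                    (sym (xor-assoc (lookup X u ∧ lookup X v) _ _))

coParity-tabulate : ∀ {n k} (f : Fin k → Subset n) u v →
                    coParity (tabulate f) u v ≡ Xor.sum (λ i → lookup (f i) u ∧ lookup (f i) v)
coParity-tabulate {k = zero}  f u v = refl
coParity-tabulate {k = suc k} f u v = cong ((lookup (f zero) u ∧ lookup (f zero) v) xor_)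
                                            (coParity-tabulate (λ i → f (suc i)) u v)

invertAll-coParity : ∀ {n} (Xs : List (Subset n)) (o : Arcs n) u v →
                     invertAll Xs o u v ≡ (if coParity Xs u v then o v u else o u v)
invertAll-coParity []       o u v = refl
invertAll-coParity (X ∷ Xs) o u v
  rewrite invertAll-coParity Xs (invert X o) u v | ∧-comm (lookup X v) (lookup X u)
  with lookup X u ∧ lookup X v | coParity Xs u v
... | true  | true  = refl
... | true  | false = refl
... | false | true  = refl
... | false | false = refl

invertAll-silent : ∀ {n} (Xs : List (Subset n)) (o : Arcs n) {u v} →
                   o u v ≡ false → o v u ≡ false → invertAll Xs o u v ≡ false
invertAll-silent Xs o {u} {v} uv vu rewrite invertAll-coParity Xs o u v | uv | vu = if-eta (coParity Xs u v)

_△_ : ∀ {n} → Arcs n → Arcs n → Arcs n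
(o₁ △ o₂) u v = o₁ u v xor o₂ u v

xor-cancelˡ : ∀ x {y z} → x xor y ≡ x xor z → y ≡ z
xor-cancelˡ true  = not-injective
xor-cancelˡ false e = e

module _ {n} {G : Graph n} where

  isOrientation-intro : ∀ {o} → (∀ u v → o u v ≡ true → Adj G u v) →
                        (∀ {u v} → Adj G u v → o v u ≡ not (o u v)) → IsOrientation G o
  isOrientation-intro {o} support reverse = support , total , asym
    where
    total : ∀ u v → Adj G u v → o u v ≡ true ⊎ o v u ≡ true
    total u v uv with o u v in e
    ... | true  = inj₁ refl
    ... | false = inj₂ (trans (reverse uv) (cong not e))
    asym : ∀ u v → o u v ≡ true → o v u ≡ true → ⊥
    asym u v uv vu with () ← trans (sym vu) (trans (reverse (support u v uv)) (cong not uv))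

  orientation-reverse : ∀ {o} → IsOrientation G o → ∀ {u v} → Adj G u v → o v u ≡ not (o u v)
  orientation-reverse {o} (_ , total , asym) {u} {v} uv with total u v uv
  ... | inj₁ uv↑ rewrite uv↑ with o v u in vu
  ...   | true  = ⊥-elim (asym u v uv↑ vu)
  ...   | false = refl
  orientation-reverse {o} (_ , total , asym) {u} {v} uv | inj₂ vu↑ rewrite vu↑ with o u v in uv↑
  ...   | true  = ⊥-elim (asym u v uv↑ vu↑)
  ...   | false = refl

  converse-isOrientation : ∀ {o} → IsOrientation G o → IsOrientation G (converse o)
  converse-isOrientation (support , total , asym) =
    (λ u v vu → Graph.sym G (support v u vu)) ,
    (λ u v uv → Sum.swap (total u v uv)) ,
    (λ u v → asym v u)

  △-sym : ∀ {o₁ o₂} → IsOrientation G o₁ → IsOrientation G o₂ → ∀ {u v} → Adj G u v →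
          (o₁ △ o₂) v u ≡ (o₁ △ o₂) u v
  △-sym {o₁} {o₂} or₁ or₂ {u} {v} uv =
    trans (cong₂ _xor_ (orientation-reverse or₁ uv) (orientation-reverse or₂ uv))
          (xor-annihilates-not (o₁ u v) (o₂ u v))

  △-converse : ∀ {o} → IsOrientation G o → ∀ {u v} → Adj G u v → (o △ converse o) u v ≡ true
  △-converse {o} or {u} {v} uv = trans (cong (o u v xor_) (orientation-reverse or uv)) (xor-inverseʳ (o u v))

  △-invertAll : ∀ {o} → IsOrientation G o → ∀ Xs {u v} → Adj G u v →
                (o △ invertAll Xs o) u v ≡ coParity Xs u v
  △-invertAll {o} or Xs {u} {v} uv
    rewrite invertAll-coParity Xs o u v | orientation-reverse or uv
    with coParity Xs u v | o u v
  ... | true  | true  = refl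
  ... | true  | false = refl
  ... | false | true  = refl
  ... | false | false = refl

  adjacent-or-silent : ∀ {o₁ o₂} → IsOrientation G o₁ → IsOrientation G o₂ → ∀ u v →
                       Adj G u v ⊎ (o₁ u v ≡ false × o₁ v u ≡ false × o₂ u v ≡ false)
  adjacent-or-silent {o₁} {o₂} (support₁ , _) (support₂ , _) u v
    with o₁ u v in uv | o₁ v u in vu | o₂ u v in uv₂
  ... | true  | _     | _     = inj₁ (support₁ u v uv)
  ... | false | true  | _     = inj₁ (Graph.sym G (support₁ v u vu))
  ... | false | false | true  = inj₁ (support₂ u v uv₂)
  ... | false | false | false = inj₂ (refl , refl , refl)

  transforms⇒coParity : ∀ {o₁ o₂} → IsOrientation G o₁ → ∀ {Xs} → invertAll Xs o₁ ≈ₒ o₂ →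
                        ∀ {u v} → Adj G u v → coParity Xs u v ≡ (o₁ △ o₂) u v
  transforms⇒coParity {o₁} or₁ {Xs} eq {u} {v} uv =
    trans (sym (△-invertAll or₁ Xs uv)) (cong (o₁ u v xor_) (eq u v))

  coParity⇒transforms : ∀ {o₁ o₂} → IsOrientation G o₁ → IsOrientation G o₂ → ∀ Xs →
                        (∀ {u v} → Adj G u v → coParity Xs u v ≡ (o₁ △ o₂) u v) →
                        invertAll Xs o₁ ≈ₒ o₂
  coParity⇒transforms {o₁} or₁ or₂ Xs agree u v with adjacent-or-silent or₁ or₂ u v
  ... | inj₁ uv = xor-cancelˡ (o₁ u v) (trans (△-invertAll or₁ Xs uv) (agree uv))
  ... | inj₂ (uv , vu , uv₂) = trans (invertAll-silent Xs o₁ uv vu) (sym uv₂)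

_≈ₒ?_ : ∀ {n} (o₁ o₂ : Arcs n) → Dec (o₁ ≈ₒ o₂)
o₁ ≈ₒ? o₂ = all? λ u → all? λ v → o₁ u v Bool.≟ o₂ u v

transforms? : ∀ {n} p j (o₁ o₂ : Arcs n) → Dec (Transforms p j o₁ o₂)
transforms? p zero o₁ o₂ =
  Dec.map′ (λ eq → [] , refl , [] , eq) (λ { ([] , _ , _ , eq) → eq }) (o₁ ≈ₒ? o₂)
transforms? p (suc j) o₁ o₂ =
  Dec.map′ (λ (X , X≤p , Xs , len , small , eq) → X ∷ Xs , cong suc len , X≤p ∷ small , eq)
           (λ { (X ∷ Xs , len , X≤p ∷ small , eq) → X , X≤p , Xs , suc-injective len , small , eq })
           (anySubset? λ X → (∣ X ∣ ≤? p) ×-dec transforms? p j (invert X o₁) o₂)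

module _ {R : ℕ → Set} (R? : Decidable R) where

  private
    searchBelow : ∀ n → (∃ λ m → R m × (∀ j → R j → m ≤ j)) ⊎ (∀ j → j < n → ¬ R j)
    searchBelow zero = inj₂ (λ _ ())
    searchBelow (suc n) with searchBelow n
    ... | inj₁ least = inj₁ least
    ... | inj₂ none with R? n
    ...   | yes Rn = inj₁ (n , Rn , λ j Rj → ≮⇒≥ (λ j<n → none j j<n Rj))
    ...   | no ¬Rn = inj₂ λ j j<1+n → [ none j , (λ { refl → ¬Rn }) ]′ (m<1+n⇒m<n∨m≡n j<1+n)

  leastWitness : ∀ {n} → R n → ∃ λ m → R m × (∀ j → R j → m ≤ j)
  leastWitness {n} Rn with searchBelow (suc n)
  ... | inj₁ least = least
  ... | inj₂ none  = contradiction Rn (none n (n<1+n n))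

pattern s₀ = zero
pattern s₁ = suc zero
pattern page j = suc (suc j)

BookAdj : ∀ {k} → Fin (2 + k) → Fin (2 + k) → Set
BookAdj s₀       s₀       = ⊥
BookAdj s₁       s₁       = ⊥
BookAdj (page _) (page _) = ⊥
BookAdj _        _        = ⊤

bookAdj-sym : ∀ {k} {u v : Fin (2 + k)} → BookAdj u v → BookAdj v u
bookAdj-sym {u = s₀}     {s₁}     _ = tt
bookAdj-sym {u = s₀}     {page _} _ = tt
bookAdj-sym {u = s₁}     {s₀}     _ = tt
bookAdj-sym {u = s₁}     {page _} _ = tt
bookAdj-sym {u = page _} {s₀}     _ = tt
bookAdj-sym {u = page _} {s₁}     _ = tt

bookAdj-irrefl : ∀ {k} {v : Fin (2 + k)} → ¬ BookAdj v v
bookAdj-irrefl {v = s₀}     ()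
bookAdj-irrefl {v = s₁}     ()
bookAdj-irrefl {v = page _} ()

Book : ∀ k → Graph (2 + k)
Book k = record { Adj = BookAdj ; sym = bookAdj-sym ; irrefl = bookAdj-irrefl }

bookEdge-elim : ∀ {k} (P : Fin (2 + k) → Fin (2 + k) → Set) →
                (∀ {u v} → BookAdj u v → P u v → P v u) →
                P s₀ s₁ → (∀ j → P s₀ (page j)) → (∀ j → P s₁ (page j)) →
                ∀ {u v} → BookAdj u v → P u v
bookEdge-elim P swap p₀₁ p₀ p₁ {s₀}     {s₁}     _ = p₀₁
bookEdge-elim P swap p₀₁ p₀ p₁ {s₀}     {page j} _ = p₀ j
bookEdge-elim P swap p₀₁ p₀ p₁ {s₁}     {s₀}     _ = swap tt p₀₁
bookEdge-elim P swap p₀₁ p₀ p₁ {s₁}     {page j} _ = p₁ j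
bookEdge-elim P swap p₀₁ p₀ p₁ {page j} {s₀}     _ = swap tt (p₀ j)
bookEdge-elim P swap p₀₁ p₀ p₁ {page j} {s₁}     _ = swap tt (p₁ j)

bookOrientation : ∀ {k} → Bool → Bool → Arcs (2 + k)
bookOrientation e f s₀       s₁       = e
bookOrientation e f s₁       s₀       = not e
bookOrientation e f s₀       (page _) = f
bookOrientation e f s₁       (page _) = f
bookOrientation e f (page _) s₀       = not f
bookOrientation e f (page _) s₁       = not f
bookOrientation e f _        _        = false

bookOrientation-isOrientation : ∀ {k} e f → IsOrientation (Book k) (bookOrientation e f)
bookOrientation-isOrientation {k} e f = isOrientation-intro {G = Book k} support
  (bookEdge-elim (λ u v → o v u ≡ not (o u v)) swap refl (λ _ → refl) (λ _ → refl))
  where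
  o : Arcs (2 + k)
  o = bookOrientation e f
  support : ∀ u v → o u v ≡ true → BookAdj u v
  support s₀       s₁       _ = tt
  support s₁       s₀       _ = tt
  support s₀       (page _) _ = tt
  support s₁       (page _) _ = tt
  support (page _) s₀       _ = tt
  support (page _) s₁       _ = tt
  swap : ∀ {u v} → BookAdj u v → o v u ≡ not (o u v) → o u v ≡ not (o v u)
  swap {u} {v} _ vu = trans (sym (not-involutive (o u v))) (cong not (sym vu))

opposite-reverses-< : ∀ {n} {i j : Fin n} → opposite i Fin.< opposite j → j Fin.< i
opposite-reverses-< {n} {i} {j} h =
  s<s⁻¹ (∸-cancelʳ-< {o = n} (subst₂ _<_ (opposite-prop i) (opposite-prop j) h))

opposite-injective : ∀ {n} → Injective _≡_ _≡_ (opposite {n})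
opposite-injective {x = i} {j} eq =
  trans (sym (opposite-involutive i)) (trans (cong opposite eq) (opposite-involutive j))

book-twoDegenerate : ∀ k → TwoDegenerate (Book k)
book-twoDegenerate k = opposite , opposite-injective , noThreeLaterNeighbours
  where
  -- Ordered by opposite, the pages come first, then s₁, then s₀.
  noThreeLaterNeighbours : ∀ (v a b c : Fin (2 + k)) → BookAdj v a → BookAdj v b → BookAdj v c →
    opposite v Fin.< opposite a → opposite v Fin.< opposite b → opposite v Fin.< opposite c →
    a ≢ b → a ≢ c → b ≢ c → ⊥
  noThreeLaterNeighbours s₀ a _ _ _ _ _ a> _ _ _ _ _ = n≮0 (opposite-reverses-< {j = a} a>)
  noThreeLaterNeighbours s₁ a b _ _ _ _ a> b> _ a≢b _ _ =
    a≢b (toℕ-injective (trans (n<1⇒n≡0 (opposite-reverses-< {j = a} a>))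
                              (sym (n<1⇒n≡0 (opposite-reverses-< {j = b} b>)))))
  noThreeLaterNeighbours (page _) s₀ s₀ _ _ _ _ _ _ _ a≢b _ _ = a≢b refl
  noThreeLaterNeighbours (page _) s₁ s₁ _ _ _ _ _ _ _ a≢b _ _ = a≢b refl
  noThreeLaterNeighbours (page _) s₀ s₁ s₀ _ _ _ _ _ _ _ a≢c _ = a≢c refl
  noThreeLaterNeighbours (page _) s₀ s₁ s₁ _ _ _ _ _ _ _ _ b≢c = b≢c refl
  noThreeLaterNeighbours (page _) s₁ s₀ s₀ _ _ _ _ _ _ _ _ b≢c = b≢c refl
  noThreeLaterNeighbours (page _) s₁ s₀ s₁ _ _ _ _ _ _ _ a≢c _ = a≢c refl

odd : ℕ → Bool
odd zero    = false
odd (suc n) = not (odd n)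

%2≡0⇒odd≡false : ∀ n → n % 2 ≡ 0 → odd n ≡ false
%2≡0⇒odd≡false zero          _ = refl
%2≡0⇒odd≡false (suc (suc n)) e = trans (not-involutive (odd n)) (%2≡0⇒odd≡false n e)

%2≡1⇒odd≡true : ∀ n → n % 2 ≡ 1 → odd n ≡ true
%2≡1⇒odd≡true (suc zero)    _ = refl
%2≡1⇒odd≡true (suc (suc n)) e = trans (not-involutive (odd n)) (%2≡1⇒odd≡true n e)

-- roundUp c w is the least m ≥ w with odd m ≡ c.
roundUp : Bool → ℕ → ℕ
roundUp c     (suc w) = suc (roundUp (not c) w)
roundUp false zero    = zero
roundUp true  zero    = 1

roundUp-mono : ∀ c {w w′} → w ≤ w′ → roundUp c w ≤ roundUp c w′
roundUp-mono false {zero}           _          = z≤n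
roundUp-mono true  {zero}  {zero}   _          = ≤-refl
roundUp-mono true  {zero}  {suc _}  _          = s≤s z≤n
roundUp-mono c     {suc _} {suc _}  (s≤s w≤w′) = s≤s (roundUp-mono (not c) w≤w′)

roundUp-not-suc : ∀ c w → roundUp (not c) (suc w) ≡ suc (roundUp c w)
roundUp-not-suc c w = cong (λ c′ → suc (roundUp c′ w)) (not-involutive c)

roundUp-2+ : ∀ c w → roundUp c (2 + w) ≡ 2 + roundUp c w
roundUp-2+ c w = cong suc (roundUp-not-suc c w)

roundUp-xor-odd : ∀ c w → roundUp c w ≡ w + (if c xor odd w then 1 else 0)
roundUp-xor-odd false zero    = refl
roundUp-xor-odd true  zero    = refl
roundUp-xor-odd c     (suc w) = cong suc (trans (roundUp-xor-odd (not c) w)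
  (cong (λ b → w + (if b then 1 else 0))
        (trans (sym (not-distribˡ-xor c (odd w))) (not-distribʳ-xor c (odd w)))))

roundUp-same-parity : ∀ {c w} → c xor odd w ≡ false → roundUp c w ≡ w
roundUp-same-parity {c} {w} e rewrite roundUp-xor-odd c w | e = +-identityʳ w

roundUp-other-parity : ∀ {c w} → c xor odd w ≡ true → roundUp c w ≡ suc w
roundUp-other-parity {c} {w} e rewrite roundUp-xor-odd c w | e = +-comm w 1

weight : ∀ {k} → (Fin k → Bool) → ℕ
weight x = ∣ Vec.tabulate x ∣

weight-xor≤ : ∀ {k} (S : Subset k) (x : Fin k → Bool) →
              weight (λ j → lookup S j xor x j) ≤ ∣ S ∣ + weight x
weight-xor≤ []      x = z≤n
weight-xor≤ (s ∷ S) x with s | x zero | weight-xor≤ S (λ j → x (suc j))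
... | true  | true  | h = ≤-trans h (≤-trans (+-monoʳ-≤ ∣ S ∣ (n≤1+n _)) (n≤1+n _))
... | true  | false | h = s≤s h
... | false | true  | h = ≤-trans (s≤s h) (≤-reflexive (sym (+-suc ∣ S ∣ _)))
... | false | false | h = h

weight-false : ∀ k → weight {k} (λ _ → false) ≡ 0
weight-false zero    = refl
weight-false (suc k) = weight-false k

weight-true : ∀ k → weight {k} (λ _ → true) ≡ k
weight-true zero    = refl
weight-true (suc k) = cong suc (weight-true k)

roundUp-weight-xor≤ : ∀ c {k} (S : Subset k) x → ∣ S ∣ ≤ 2 →
                      roundUp c (weight (λ j → lookup S j xor x j)) ≤ 2 + roundUp c (weight x)
roundUp-weight-xor≤ c S x ∣S∣≤2 = begin
  roundUp c (weight (λ j → lookup S j xor x j))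
    ≤⟨ roundUp-mono c (≤-trans (weight-xor≤ S x) (+-monoˡ-≤ (weight x) ∣S∣≤2)) ⟩
  roundUp c (2 + weight x)  ≡⟨ roundUp-2+ c (weight x) ⟩
  2 + roundUp c (weight x)  ∎
  where open ≤-Reasoning

roundUp-not-weight-xor≤ : ∀ c {k} (S : Subset k) x → ∣ S ∣ ≤ 1 →
                          roundUp (not c) (weight (λ j → lookup S j xor x j)) ≤ 1 + roundUp c (weight x)
roundUp-not-weight-xor≤ c S x ∣S∣≤1 = begin
  roundUp (not c) (weight (λ j → lookup S j xor x j))
    ≤⟨ roundUp-mono (not c) (≤-trans (weight-xor≤ S x) (+-monoˡ-≤ (weight x) ∣S∣≤1)) ⟩
  roundUp (not c) (1 + weight x)  ≡⟨ roundUp-not-suc c (weight x) ⟩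
  1 + roundUp c (weight x)        ∎
  where open ≤-Reasoning

potential : ∀ {k} → Arcs (2 + k) → ℕ
potential ℓ = roundUp (ℓ s₀ s₁) (weight λ j → ℓ s₀ (page j))
            + roundUp (ℓ s₀ s₁) (weight λ j → ℓ s₁ (page j))

potential-cong : ∀ {k} {ℓ ℓ′ : Arcs (2 + k)} →
                 (∀ {u v} → BookAdj u v → ℓ u v ≡ ℓ′ u v) → potential ℓ ≡ potential ℓ′
potential-cong agree = cong₂ _+_
  (cong₂ roundUp (agree {s₀} {s₁} tt) (cong ∣_∣ (tabulate-cong λ j → agree {s₀} {page j} tt)))
  (cong₂ roundUp (agree {s₀} {s₁} tt) (cong ∣_∣ (tabulate-cong λ j → agree {s₁} {page j} tt)))

potential-step : ∀ {k} α β (S : Subset k) Xs → ∣ α ∷ β ∷ S ∣ ≤ 3 →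
                 potential (coParity ((α ∷ β ∷ S) ∷ Xs)) ≤ 2 + potential (coParity Xs)
potential-step false false S Xs _ = m≤n+m _ 2
potential-step true  false S Xs (s≤s ∣S∣≤2) =
  +-monoˡ-≤ _ (roundUp-weight-xor≤ z S (λ j → coParity Xs s₀ (page j)) ∣S∣≤2)
  where
  z : Bool
  z = coParity Xs s₀ s₁
potential-step false true  S Xs (s≤s ∣S∣≤2) =
  ≤-trans (+-monoʳ-≤ _ (roundUp-weight-xor≤ z S (λ j → coParity Xs s₁ (page j)) ∣S∣≤2))
          (≤-reflexive (trans (+-suc _ _) (cong suc (+-suc _ _))))
  where
  z : Bool
  z = coParity Xs s₀ s₁
potential-step true  true  S Xs (s≤s (s≤s ∣S∣≤1)) =
  ≤-trans (+-mono-≤ (roundUp-not-weight-xor≤ z S (λ j → coParity Xs s₀ (page j)) ∣S∣≤1)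
                    (roundUp-not-weight-xor≤ z S (λ j → coParity Xs s₁ (page j)) ∣S∣≤1))
          (≤-reflexive (cong suc (+-suc _ _)))
  where
  z : Bool
  z = coParity Xs s₀ s₁

potential-coParity : ∀ {k} (Xs : List (Subset (2 + k))) → All (λ X → ∣ X ∣ ≤ 3) Xs →
                     potential (coParity Xs) ≤ 2 * length Xs
potential-coParity {k} [] [] = ≤-reflexive (cong₂ _+_ nothingReversed nothingReversed)
  where
  nothingReversed : roundUp false (weight {k} λ _ → false) ≡ 0
  nothingReversed = cong (roundUp false) (weight-false k)
potential-coParity ((α ∷ β ∷ S) ∷ Xs) (X≤3 ∷ small) = begin
  potential (coParity ((α ∷ β ∷ S) ∷ Xs)) ≤⟨ potential-step α β S Xs X≤3 ⟩
  2 + potential (coParity Xs)             ≤⟨ +-monoʳ-≤ 2 (potential-coParity Xs small) ⟩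
  2 + 2 * length Xs                       ≡⟨ *-suc 2 (length Xs) ⟨
  2 * length ((α ∷ β ∷ S) ∷ Xs)           ∎
  where open ≤-Reasoning

TrueOnPages : ∀ {k} → Arcs (2 + k) → Set
TrueOnPages ℓ = ∀ j → ℓ s₀ (page j) ≡ true × ℓ s₁ (page j) ≡ true

potential-trueOnPages : ∀ {k} {ℓ : Arcs (2 + k)} → TrueOnPages ℓ → potential ℓ ≡ 2 * roundUp (ℓ s₀ s₁) k
potential-trueOnPages {k} {ℓ} pages = begin
  potential ℓ                               ≡⟨ cong₂ _+_ (allPages (proj₁ ∘ pages)) (allPages (proj₂ ∘ pages)) ⟩
  roundUp (ℓ s₀ s₁) k + roundUp (ℓ s₀ s₁) k ≡⟨ cong (roundUp (ℓ s₀ s₁) k +_) (+-identityʳ _) ⟨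
  2 * roundUp (ℓ s₀ s₁) k                   ∎
  where
  open ≡-Reasoning
  allPages : ∀ {s} → (∀ j → ℓ s (page j) ≡ true) →
             roundUp (ℓ s₀ s₁) (weight λ j → ℓ s (page j)) ≡ roundUp (ℓ s₀ s₁) k
  allPages p = cong (roundUp (ℓ s₀ s₁)) (trans (cong ∣_∣ (tabulate-cong p)) (weight-true k))

Xor-sum-∧-⁅⁆ : ∀ {k} (x : Fin k → Bool) j → Xor.sum (λ i → x i ∧ lookup ⁅ i ⁆ j) ≡ x j
Xor-sum-∧-⁅⁆ {suc k} x zero = begin
  (x zero ∧ true) xor Xor.sum (λ i → x (suc i) ∧ false)
    ≡⟨ cong₂ _xor_ (∧-identityʳ (x zero))
                   (trans (Xor.sum-cong-≗ (λ i → ∧-zeroʳ (x (suc i)))) (Xor.sum-replicate-zero k)) ⟩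
  x zero xor false ≡⟨ xor-identityʳ (x zero) ⟩
  x zero           ∎
  where open ≡-Reasoning
Xor-sum-∧-⁅⁆ x (suc j) =
  cong₂ _xor_ (trans (cong (x zero ∧_) (lookup-replicate j false)) (∧-zeroʳ (x zero)))
              (Xor-sum-∧-⁅⁆ (λ i → x (suc i)) j)

Xor-sum-true : ∀ k → Xor.sum {k} (λ _ → true) ≡ odd k
Xor-sum-true zero    = refl
Xor-sum-true (suc k) = cong not (Xor-sum-true k)

pageInversion : ∀ {k} → Arcs (2 + k) → Fin k → Subset (2 + k)
pageInversion ℓ j = ℓ s₀ (page j) ∷ ℓ s₁ (page j) ∷ ⁅ j ⁆

pageInversions : ∀ {k} → Arcs (2 + k) → List (Subset (2 + k))
pageInversions ℓ = tabulate (pageInversion ℓ)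

spineInversion : ∀ {k} → Bool → List (Subset (2 + k))
spineInversion b = if b then (true ∷ true ∷ ∅) ∷ [] else []

spineFix : ∀ {k} → Arcs (2 + k) → Bool
spineFix ℓ = ℓ s₀ s₁ xor coParity (pageInversions ℓ) s₀ s₁

bookInversions : ∀ {k} → Arcs (2 + k) → List (Subset (2 + k))
bookInversions ℓ = pageInversions ℓ ++ spineInversion (spineFix ℓ)

∣x∷p∣≤1+∣p∣ : ∀ {n} x (p : Subset n) → ∣ x ∷ p ∣ ≤ suc ∣ p ∣
∣x∷p∣≤1+∣p∣ true  p = ≤-refl
∣x∷p∣≤1+∣p∣ false p = n≤1+n ∣ p ∣

bookInversions-small : ∀ {k} (ℓ : Arcs (2 + k)) → All (λ X → ∣ X ∣ ≤ 3) (bookInversions ℓ)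
bookInversions-small {k} ℓ =
  ++⁺ (tabulate⁺ λ j → pageSmall (ℓ s₀ (page j)) (ℓ s₁ (page j)) j) (spineSmall (spineFix ℓ))
  where
  pageSmall : ∀ x y (j : Fin k) → ∣ x ∷ y ∷ ⁅ j ⁆ ∣ ≤ 3
  pageSmall x y j = ≤-trans (∣x∷p∣≤1+∣p∣ x (y ∷ ⁅ j ⁆))
    (s≤s (≤-trans (∣x∷p∣≤1+∣p∣ y ⁅ j ⁆) (s≤s (≤-reflexive (∣⁅x⁆∣≡1 j)))))
  spineSmall : ∀ b → All (λ X → ∣ X ∣ ≤ 3) (spineInversion {k} b)
  spineSmall true  = s≤s (s≤s (subst (_≤ 1) (sym (∣⊥∣≡0 k)) z≤n)) ∷ []
  spineSmall false = []

coParity-spineInversion-spine : ∀ {k} b → coParity (spineInversion {k} b) s₀ s₁ ≡ b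
coParity-spineInversion-spine true  = refl
coParity-spineInversion-spine false = refl

coParity-spineInversion-page : ∀ {k} b s j → coParity (spineInversion {k} b) s (page j) ≡ false
coParity-spineInversion-page {k} true s j
  rewrite lookup-replicate {n = k} j false | ∧-zeroʳ (lookup (true ∷ true ∷ ∅ {k}) s) = refl
coParity-spineInversion-page false s j = refl

bookInversions-coParity : ∀ {k} {ℓ : Arcs (2 + k)} → (∀ {u v} → BookAdj u v → ℓ v u ≡ ℓ u v) →
                          ∀ {u v} → BookAdj u v → coParity (bookInversions ℓ) u v ≡ ℓ u v
bookInversions-coParity {k} {ℓ} ℓ-sym =
  bookEdge-elim (λ u v → coParity (bookInversions ℓ) u v ≡ ℓ u v) swap spine (onPage s₀) (onPage s₁)
  where
  open ≡-Reasoning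
  pages : List (Subset (2 + k))
  pages = pageInversions ℓ
  swap : ∀ {u v} → BookAdj u v → coParity (bookInversions ℓ) u v ≡ ℓ u v →
         coParity (bookInversions ℓ) v u ≡ ℓ v u
  swap {u} {v} uv e = trans (coParity-sym (bookInversions ℓ) v u) (trans e (sym (ℓ-sym uv)))
  spine : coParity (bookInversions ℓ) s₀ s₁ ≡ ℓ s₀ s₁
  spine = begin
    coParity (bookInversions ℓ) s₀ s₁ ≡⟨ coParity-++ pages _ s₀ s₁ ⟩
    coParity pages s₀ s₁ xor coParity (spineInversion (spineFix ℓ)) s₀ s₁
      ≡⟨ cong (coParity pages s₀ s₁ xor_) (coParity-spineInversion-spine (spineFix ℓ)) ⟩
    c xor (ℓ s₀ s₁ xor c)             ≡⟨ cong (c xor_) (xor-comm (ℓ s₀ s₁) c) ⟩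
    c xor (c xor ℓ s₀ s₁)             ≡⟨ xor-assoc c c (ℓ s₀ s₁) ⟨
    (c xor c) xor ℓ s₀ s₁             ≡⟨ cong (_xor ℓ s₀ s₁) (xor-same c) ⟩
    ℓ s₀ s₁                           ∎
    where
    c : Bool
    c = coParity pages s₀ s₁
  onPage : ∀ s j → coParity (bookInversions ℓ) s (page j) ≡ lookup (pageInversion ℓ j) s
  onPage s j = begin
    coParity (bookInversions ℓ) s (page j) ≡⟨ coParity-++ pages _ s (page j) ⟩
    coParity pages s (page j) xor coParity (spineInversion (spineFix ℓ)) s (page j)
      ≡⟨ cong₂ _xor_ (coParity-tabulate (pageInversion ℓ) s (page j))
                     (coParity-spineInversion-page (spineFix ℓ) s j) ⟩
    Xor.sum (λ i → x i ∧ lookup ⁅ i ⁆ j) xor false ≡⟨ xor-identityʳ _ ⟩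
    Xor.sum (λ i → x i ∧ lookup ⁅ i ⁆ j)           ≡⟨ Xor-sum-∧-⁅⁆ x j ⟩
    x j                                             ∎
    where
    x : Fin k → Bool
    x i = lookup (pageInversion ℓ i) s

length-bookInversions : ∀ {k} (ℓ : Arcs (2 + k)) →
                        length (bookInversions ℓ) ≡ k + (if spineFix ℓ then 1 else 0)
length-bookInversions ℓ = trans (length-++ (pageInversions ℓ))
  (cong₂ _+_ (length-tabulate (pageInversion ℓ)) (if-float length (spineFix ℓ)))

length-bookInversions≤ : ∀ {k} (ℓ : Arcs (2 + k)) → length (bookInversions ℓ) ≤ suc k
length-bookInversions≤ {k} ℓ rewrite length-bookInversions ℓ with spineFix ℓ
... | true  = ≤-reflexive (+-comm k 1)
... | false = ≤-trans (≤-reflexive (+-identityʳ k)) (n≤1+n k)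

length-bookInversions-trueOnPages : ∀ {k} {ℓ : Arcs (2 + k)} → TrueOnPages ℓ →
                                    length (bookInversions ℓ) ≡ roundUp (ℓ s₀ s₁) k
length-bookInversions-trueOnPages {k} {ℓ} pages = begin
  length (bookInversions ℓ)                ≡⟨ length-bookInversions ℓ ⟩
  k + (if spineFix ℓ then 1 else 0)        ≡⟨ cong (λ b → k + (if ℓ s₀ s₁ xor b then 1 else 0)) spineParity ⟩
  k + (if ℓ s₀ s₁ xor odd k then 1 else 0) ≡⟨ roundUp-xor-odd (ℓ s₀ s₁) k ⟨
  roundUp (ℓ s₀ s₁) k                      ∎
  where
  open ≡-Reasoning
  spineParity : coParity (pageInversions ℓ) s₀ s₁ ≡ odd k
  spineParity = trans (coParity-tabulate (pageInversion ℓ) s₀ s₁)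
    (trans (Xor.sum-cong-≗ (λ i → cong₂ _∧_ (proj₁ (pages i)) (proj₂ (pages i)))) (Xor-sum-true k))

module _ {k} {o₁ o₂ : Arcs (2 + k)} (or₁ : IsOrientation (Book k) o₁) where

  book-potential≤ : ∀ {j} → Transforms 3 j o₁ o₂ → potential (o₁ △ o₂) ≤ 2 * j
  book-potential≤ (Xs , refl , small , eq) =
    subst (_≤ 2 * length Xs) (potential-cong (transforms⇒coParity {G = Book k} or₁ {Xs} eq))
          (potential-coParity Xs small)

  module _ (or₂ : IsOrientation (Book k) o₂) where

    book-transforms : Transforms 3 (length (bookInversions (o₁ △ o₂))) o₁ o₂
    book-transforms = bookInversions (o₁ △ o₂) , refl , bookInversions-small (o₁ △ o₂) ,
      coParity⇒transforms {G = Book k} or₁ or₂ (bookInversions (o₁ △ o₂))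
                          (bookInversions-coParity (△-sym {G = Book k} or₁ or₂))

    book-diameter≤ : ∃ λ m → MinInv 3 o₁ o₂ m × m ≤ suc k
    book-diameter≤ with leastWitness (λ j → transforms? 3 j o₁ o₂) book-transforms
    ... | m , t , least =
      m , (t , least) , ≤-trans (least _ book-transforms) (length-bookInversions≤ (o₁ △ o₂))

    book-minInv-trueOnPages : TrueOnPages (o₁ △ o₂) → MinInv 3 o₁ o₂ (roundUp ((o₁ △ o₂) s₀ s₁) k)
    book-minInv-trueOnPages pages =
      subst (λ m → Transforms 3 m o₁ o₂) (length-bookInversions-trueOnPages {ℓ = o₁ △ o₂} pages)
            book-transforms ,
      λ j t → *-cancelˡ-≤ 2 (subst (_≤ 2 * j) (potential-trueOnPages {ℓ = o₁ △ o₂} pages)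
                                   (book-potential≤ t))

book-conv : ∀ {k} {o : Arcs (2 + k)} → IsOrientation (Book k) o → MinInv 3 o (converse o) (roundUp true k)
book-conv {k} {o} or = subst (MinInv 3 o (converse o)) (cong (λ c → roundUp c k) (reversed tt))
  (book-minInv-trueOnPages or (converse-isOrientation {G = Book k} or) λ _ → reversed tt , reversed tt)
  where
  reversed : ∀ {u v} → BookAdj u v → (o △ converse o) u v ≡ true
  reversed = △-converse {G = Book k} or

book-diameter-attained : ∀ k → MinInv 3 (bookOrientation {k} true true) (bookOrientation (odd k) false) (suc k)
book-diameter-attained k = subst (MinInv 3 _ _) (roundUp-other-parity (xor-inverseˡ (odd k)))
  (book-minInv-trueOnPages (bookOrientation-isOrientation true true) (bookOrientation-isOrientation (odd k) false)
                           λ _ → refl , refl)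

proposition33 : ∀ (n : ℕ) → 2 ≤ n →
    Σ (Graph n) λ G →
      TwoDegenerate G ×
      InvDiamEq 3 G (n ∸ 1) ×
      (n % 2 ≡ 0 → ConvEq 3 G (n ∸ 1)) ×
      (n % 2 ≡ 1 → ConvEq 3 G (n ∸ 2))
proposition33 (suc (suc k)) (s≤s (s≤s z≤n)) =
  Book k , book-twoDegenerate k ,
  ((λ _ _ → book-diameter≤) , bookOrientation true true , bookOrientation (odd k) false ,
    bookOrientation-isOrientation true true , bookOrientation-isOrientation (odd k) false ,
    book-diameter-attained k) ,
  (λ n-even o or → subst (MinInv 3 o (converse o))
                         (roundUp-other-parity (cong not (%2≡0⇒odd≡false k n-even))) (book-conv or)) ,
  (λ n-odd o or → subst (MinInv 3 o (converse o))
                        (roundUp-same-parity (cong not (%2≡1⇒odd≡true k n-odd))) (book-conv or))
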